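{- Let $k,\ell,b,n_1,n_2$ be positive integers with $k,\ell\leq b$, $2(k+b)<n_1$, $2(\ell+b)<n_2$. Let $\mathcal{R}$ be a proj-intersecting family of $k\times\ell$ rectangles in $\mathbb{Z}_{n_1}\times\mathbb{Z}_{n_2}$. Suppose that the number of distinct bases $J_0$ of $b$-blocking pairs $I_1\times J_0, I_2\times J_0$ (with $d(I_1,I_2)\geq b+1$) contained in $\mathcal{R}$ is at least $1$ and at most $\ell-1$. Then $$|\mathcal{R}|\leq 4b^2+(\ell-1)n_1.$$
   Context: For $u,v\in\mathbb{Z}_n$ the distance $d(u,v)$ is the smaller of $(u-v)\bmod n$ and $(v-u)\bmod n$. An interval of length $a$ in $\mathbb{Z}_n$ is a set $\{i+1,\ldots,i+a\}$ (mod $n$); the distance of two intervals is the minimum distance between an element of one and an element of the other. A $k\times\ell$ rectangle is $I\times J$ with $I$ an interval of length $k$ in $\mathbb{Z}_{n_1}$ and $J$ an interval of length $\ell$ in $\mathbb{Z}_{n_2}$. Rectangles $I\times J$, $I'\times J'$ are proj-intersecting if $I\cap I'\neq\emptyset$ or $J\cap J'\neq\emptyset$; a family is proj-intersecting if every two members are. Two rectangles $R_1=I_1\times J_0$, $R_2=I_2\times J_0$ with $d(I_1,I_2)\geq b+1$ form a $b$-blocking pair with base $J_0$. -}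

module Defs where

open import Data.Nat using (ℕ; zero; suc; _+_; _*_; _∸_; _≤_; _⊓_; NonZero)
open import Data.Nat.DivMod using (_%_)
open import Data.Fin using (Fin; toℕ)
open import Data.Product using (Σ; ∃; _×_; _,_)
open import Data.Sum using (_⊎_)
open import Data.List using (List)
open import Data.List.Membership.Propositional using (_∈_)
open import Relation.Binary.PropositionalEquality using (_≡_)

dist : (n : ℕ) → .{{_ : NonZero n}} → Fin n → Fin n → ℕ
dist n u v = ((toℕ u + n ∸ toℕ v) % n) ⊓ ((toℕ v + n ∸ toℕ u) % n)

-- An interval of length a with "start" i is {i+1,…,i+a} (mod n).
-- x ∈ Interval n i a
InInterval : (n : ℕ) → .{{_ : NonZero n}} → (i : Fin n) → (a : ℕ) → Fin n → Set
InInterval n i a x = ∃ λ t → (1 ≤ t) × (t ≤ a) × (toℕ x ≡ (toℕ i + t) % n)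

IntervalsMeet : (n : ℕ) → .{{_ : NonZero n}} → (a : ℕ) → Fin n → Fin n → Set
IntervalsMeet n a i i' = ∃ λ x → InInterval n i a x × InInterval n i' a x

IntervalDist≥ : (n : ℕ) → .{{_ : NonZero n}} → (a : ℕ) → Fin n → Fin n → ℕ → Set
IntervalDist≥ n a i i' c =
  ∀ x y → InInterval n i a x → InInterval n i' a y → c ≤ dist n x y

-- A k×ℓ rectangle I×J in ℤ_{n₁}×ℤ_{n₂} is given by the starts (i , j) of I and J.
Rect : ℕ → ℕ → Set
Rect n₁ n₂ = Fin n₁ × Fin n₂

ProjIntersecting : (n₁ n₂ : ℕ) → .{{_ : NonZero n₁}} → .{{_ : NonZero n₂}} →
                   (k ℓ : ℕ) → Rect n₁ n₂ → Rect n₁ n₂ → Set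
ProjIntersecting n₁ n₂ k ℓ (i , j) (i' , j') =
  IntervalsMeet n₁ k i i' ⊎ IntervalsMeet n₂ ℓ j j'

ProjIntersectingFamily : (n₁ n₂ : ℕ) → .{{_ : NonZero n₁}} → .{{_ : NonZero n₂}} →
                         (k ℓ : ℕ) → List (Rect n₁ n₂) → Set
ProjIntersectingFamily n₁ n₂ k ℓ ℛ =
  ∀ R R' → R ∈ ℛ → R' ∈ ℛ → ProjIntersecting n₁ n₂ k ℓ R R'

IsBlockingBase : (n₁ n₂ : ℕ) → .{{_ : NonZero n₁}} → .{{_ : NonZero n₂}} →
                 (k b : ℕ) → List (Rect n₁ n₂) → Fin n₂ → Set
IsBlockingBase n₁ n₂ k b ℛ j =
  ∃ λ i₁ → ∃ λ i₂ → ((i₁ , j) ∈ ℛ) × ((i₂ , j) ∈ ℛ) × IntervalDist≥ n₁ k i₁ i₂ (suc b)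

-- Fix a blocking pair I₁ × J₀, I₂ × J₀ of ℛ. A rectangle I × J of ℛ cannot meet both I₁ and
-- I₂, which are more than b ≥ k apart, so J meets J₀: all bases of ℛ lie within distance ℓ − 1
-- of J₀, i.e. among 2ℓ − 1 positions. A blocking base carries at most n₁ rectangles. On any
-- other base, two rectangles of ℛ do not form a blocking pair, so all their horizontal starts lie
-- within distance b + k − 1 of one of them, leaving at most 2(b + k) − 1 ≤ 4b rectangles. With at
-- most ℓ − 1 blocking bases, |ℛ| ≤ (ℓ − 1) n₁ + ℓ (2(b + k) − 1) ≤ (ℓ − 1) n₁ + 4b².
module Submission where

open import Defs
open import Data.Nat using (ℕ; suc; _+_; _*_; _∸_; _≤_; _<_; NonZero; z≤n; s≤s)
open import Data.Nat.Properties hiding (_≟_)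
open import Data.Nat.DivMod
  using (_%_; _/_; m%n<n; m<n⇒m%n≡m; m≡m%n+[m/n]*n; %-distribˡ-+; m%n%n≡m%n; [m+n]%n≡m%n;
         [m+kn]%n≡m%n)
open import Data.Nat.Tactic.RingSolver using (solve-∀)
open import Data.Fin using (Fin; toℕ; fromℕ<; _≟_)
open import Data.Fin.Properties using (toℕ<n; toℕ-fromℕ<; toℕ-injective)
open import Data.Product using (_,_; proj₁; proj₂)
open import Data.Sum using (_⊎_; inj₁; inj₂)
open import Data.Empty using (⊥-elim)
open import Data.List using (List; []; _∷_; _++_; length; map; filter; concatMap; allFin; applyUpTo)
open import Data.List.Properties
  using (length-map; length-applyUpTo; length-tabulate; length-++; length-removeAt′)
open import Data.List.Membership.Propositional using (_∈_)
open import Data.List.Membership.Propositional.Properties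
  using (∈-map⁺; ∈-filter⁺; ∈-filter⁻; ∈-allFin; ∈-applyUpTo⁺; ∈-concatMap⁺)
open import Data.List.Relation.Unary.Any as Any using (here; there; _─_)
open import Data.List.Relation.Unary.All using (lookup)
open import Data.List.Relation.Unary.AllPairs using (_∷_)
open import Data.List.Relation.Unary.Unique.Propositional using (Unique)
open import Data.List.Relation.Unary.Unique.Propositional.Properties using (filter⁺; applyUpTo⁺₁)
open import Function.Base using (_∘_)
open import Function.Bundles using (_⇔_; Equivalence)
open import Relation.Binary.PropositionalEquality
open import Relation.Nullary using (yes; no; ¬_)
open import Relation.Unary using (Decidable)

module _ {a} {A : Set a} where

  ∈-─ : ∀ {x z} (ys : List A) (p : x ∈ ys) → z ∈ ys → x ≢ z → z ∈ (ys ─ p)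
  ∈-─ (y ∷ ys) (here refl) (here refl) x≢z = ⊥-elim (x≢z refl)
  ∈-─ (y ∷ ys) (here _)    (there z∈)  _   = z∈
  ∈-─ (y ∷ ys) (there p)   (here refl) _   = here refl
  ∈-─ (y ∷ ys) (there p)   (there z∈)  x≢z = there (∈-─ ys p z∈ x≢z)

  Unique-⊆⇒length≤ : ∀ {xs ys : List A} → Unique xs → (∀ {z} → z ∈ xs → z ∈ ys) →
                     length xs ≤ length ys
  Unique-⊆⇒length≤ {[]}     _          _  = z≤n
  Unique-⊆⇒length≤ {x ∷ xs} {ys} (x∉ ∷ u) xs⊆ys =
    subst (suc (length xs) ≤_) (sym (length-removeAt′ ys (Any.index x∈ys)))
      (s≤s (Unique-⊆⇒length≤ u λ z∈ → ∈-─ ys x∈ys (xs⊆ys (there z∈)) (lookup x∉ z∈)))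
    where x∈ys = xs⊆ys (here refl)

  Unique⇒length≤-around : ∀ {c} {xs : List A} (around : A → List A) → Unique xs →
                          (∀ {x y} → x ∈ xs → y ∈ xs → y ∈ around x) →
                          (∀ x → length (around x) ≤ c) → length xs ≤ c
  Unique⇒length≤-around {xs = []}     _      _ _       _     = z≤n
  Unique⇒length≤-around {xs = x ∷ xs} around u clustered short =
    ≤-trans (Unique-⊆⇒length≤ u (clustered (here refl))) (short x)

  length-concatMap≤ : ∀ {b p} {B : Set b} {P : A → Set p} (P? : Decidable P)
                      (f : A → List B) {c e} →
                      (∀ x → ¬ P x → length (f x) ≤ c) → (∀ x → length (f x) ≤ c + e) →
                      ∀ xs → length (concatMap f xs) ≤ length xs * c + length (filter P? xs) * e
  length-concatMap≤ P? f short long [] = z≤n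
  length-concatMap≤ P? f {c} {e} short long (x ∷ xs) with P? x
  ... | yes _ = begin
    length (f x ++ concatMap f xs)
      ≡⟨ length-++ (f x) ⟩
    length (f x) + length (concatMap f xs)
      ≤⟨ +-mono-≤ (long x) (length-concatMap≤ P? f short long xs) ⟩
    (c + e) + (L * c + F * e)
      ≡⟨ rearrange c e L F ⟩
    suc L * c + suc F * e ∎
    where
      open ≤-Reasoning
      L = length xs
      F = length (filter P? xs)
      rearrange : ∀ c e L F → (c + e) + (L * c + F * e) ≡ suc L * c + suc F * e
      rearrange = solve-∀
  ... | no ¬px = begin
    length (f x ++ concatMap f xs)
      ≡⟨ length-++ (f x) ⟩
    length (f x) + length (concatMap f xs)
      ≤⟨ +-mono-≤ (short x ¬px) (length-concatMap≤ P? f short long xs) ⟩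
    c + (length xs * c + length (filter P? xs) * e)
      ≡⟨ +-assoc c _ _ ⟨
    suc (length xs) * c + length (filter P? xs) * e ∎
    where open ≤-Reasoning

module _ (n : ℕ) .{{_ : NonZero n}} where

  %-cong-+ʳ : ∀ {a b} c → a % n ≡ b % n → (a + c) % n ≡ (b + c) % n
  %-cong-+ʳ {a} {b} c eq = begin
    (a + c) % n           ≡⟨ %-distribˡ-+ a c n ⟩
    (a % n + c % n) % n   ≡⟨ cong (λ z → (z + c % n) % n) eq ⟩
    (b % n + c % n) % n   ≡⟨ %-distribˡ-+ b c n ⟨
    (b + c) % n           ∎
    where open ≡-Reasoning

  [m%n+k]%n≡[m+k]%n : ∀ a c → (a % n + c) % n ≡ (a + c) % n
  [m%n+k]%n≡[m+k]%n a c = %-cong-+ʳ c (m%n%n≡m%n a n)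

  [m+k%n]%n≡[m+k]%n : ∀ a c → (a + c % n) % n ≡ (a + c) % n
  [m+k%n]%n≡[m+k]%n a c = begin
    (a + c % n) % n   ≡⟨ cong (_% n) (+-comm a (c % n)) ⟩
    (c % n + a) % n   ≡⟨ [m%n+k]%n≡[m+k]%n c a ⟩
    (c + a) % n       ≡⟨ cong (_% n) (+-comm c a) ⟩
    (a + c) % n       ∎
    where open ≡-Reasoning

  -- Adding n ∸ c % n completes c to a multiple of n.
  %-cancel-+ʳ : ∀ {a b} c → (a + c) % n ≡ (b + c) % n → a % n ≡ b % n
  %-cancel-+ʳ {a} {b} c eq = begin
    a % n                      ≡⟨ [m+kn]%n≡m%n a (suc (c / n)) n ⟨
    (a + suc (c / n) * n) % n  ≡⟨ cong (λ z → (a + z) % n) c+e≡kn ⟨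
    (a + (c + e)) % n          ≡⟨ cong (_% n) (+-assoc a c e) ⟨
    (a + c + e) % n            ≡⟨ %-cong-+ʳ e eq ⟩
    (b + c + e) % n            ≡⟨ cong (_% n) (+-assoc b c e) ⟩
    (b + (c + e)) % n          ≡⟨ cong (λ z → (b + z) % n) c+e≡kn ⟩
    (b + suc (c / n) * n) % n  ≡⟨ [m+kn]%n≡m%n b (suc (c / n)) n ⟩
    b % n                      ∎
    where
      open ≡-Reasoning
      e = n ∸ c % n
      c+e≡kn : c + e ≡ suc (c / n) * n
      c+e≡kn = begin
        c + e                          ≡⟨ cong (_+ e) (m≡m%n+[m/n]*n c n) ⟩
        c % n + c / n * n + e          ≡⟨ cong (_+ e) (+-comm (c % n) _) ⟩
        c / n * n + c % n + e          ≡⟨ +-assoc (c / n * n) _ e ⟩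
        c / n * n + (c % n + e)        ≡⟨ cong (c / n * n +_) (m+[n∸m]≡n (<⇒≤ (m%n<n c n))) ⟩
        c / n * n + n                  ≡⟨ +-comm (c / n * n) n ⟩
        suc (c / n) * n                ∎

module Cyclic (n : ℕ) .{{_ : NonZero n}} where

  -- The offset from y forward to x; dist n x y unfolds to (x ⊖ y) ⊓ (y ⊖ x).
  _⊖_ : Fin n → Fin n → ℕ
  x ⊖ y = (toℕ x + n ∸ toℕ y) % n

  [toℕ+n]%n≡toℕ : (x : Fin n) → (toℕ x + n) % n ≡ toℕ x
  [toℕ+n]%n≡toℕ x = trans ([m+n]%n≡m%n (toℕ x) n) (m<n⇒m%n≡m (toℕ<n x))

  offset-+ : ∀ {y : Fin n} (i : Fin n) u e → toℕ y ≡ (toℕ i + u) % n →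
             (toℕ y + e) % n ≡ (toℕ i + (u + e)) % n
  offset-+ {y} i u e y≡ = begin
    (toℕ y + e) % n             ≡⟨ cong (λ z → (z + e) % n) y≡ ⟩
    ((toℕ i + u) % n + e) % n   ≡⟨ [m%n+k]%n≡[m+k]%n n (toℕ i + u) e ⟩
    (toℕ i + u + e) % n         ≡⟨ cong (_% n) (+-assoc (toℕ i) u e) ⟩
    (toℕ i + (u + e)) % n       ∎
    where open ≡-Reasoning

  ⊖-unique : ∀ {x y : Fin n} {e} → e < n → toℕ x ≡ (toℕ y + e) % n → x ⊖ y ≡ e
  ⊖-unique {x} {y} {e} e<n x≡ =
    trans (%-cancel-+ʳ n (toℕ y) shifted) (m<n⇒m%n≡m e<n)
    where
      open ≡-Reasoning
      shifted : (toℕ x + n ∸ toℕ y + toℕ y) % n ≡ (e + toℕ y) % n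
      shifted = begin
        (toℕ x + n ∸ toℕ y + toℕ y) % n
          ≡⟨ cong (_% n) (m∸n+n≡m (≤-trans (<⇒≤ (toℕ<n y)) (m≤n+m n (toℕ x)))) ⟩
        (toℕ x + n) % n   ≡⟨ [toℕ+n]%n≡toℕ x ⟩
        toℕ x             ≡⟨ x≡ ⟩
        (toℕ y + e) % n   ≡⟨ cong (_% n) (+-comm (toℕ y) e) ⟩
        (e + toℕ y) % n   ∎

  ⊖-offset : ∀ x y → toℕ x ≡ (toℕ y + x ⊖ y) % n
  ⊖-offset x y = begin
    toℕ x                               ≡⟨ [toℕ+n]%n≡toℕ x ⟨
    (toℕ x + n) % n                     ≡⟨ cong (_% n) (m+[n∸m]≡n y≤x+n) ⟨
    (toℕ y + (toℕ x + n ∸ toℕ y)) % n   ≡⟨ [m+k%n]%n≡[m+k]%n n (toℕ y) _ ⟨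
    (toℕ y + x ⊖ y) % n                 ∎
    where
      open ≡-Reasoning
      y≤x+n = ≤-trans (<⇒≤ (toℕ<n y)) (m≤n+m n (toℕ x))

  ⊖-< : ∀ x y → x ⊖ y < n
  ⊖-< x y = m%n<n _ n

  ⊖-within-interval : ∀ {i x y : Fin n} {a t u} → a ≤ n → 1 ≤ u → t ≤ a → u ≤ t →
                      toℕ x ≡ (toℕ i + t) % n → toℕ y ≡ (toℕ i + u) % n → x ⊖ y < a
  ⊖-within-interval {i} {u = u} a≤n 1≤u t≤a u≤t x≡ y≡ with m≤n⇒∃[o]m+o≡n u≤t
  ... | e , refl = subst (_< _) (sym (⊖-unique (<-≤-trans e<a a≤n) x≡y+e)) e<a
    where
      e<a = ≤-trans (+-monoˡ-≤ e 1≤u) t≤a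
      x≡y+e = trans x≡ (sym (offset-+ i u e y≡))

  InInterval⇒dist< : ∀ {i x y : Fin n} {a} → a ≤ n → InInterval n i a x → InInterval n i a y →
                     dist n x y < a
  InInterval⇒dist< a≤n (t , 1≤t , t≤a , x≡) (u , 1≤u , u≤a , y≡) with ≤-total u t
  ... | inj₁ u≤t = ≤-<-trans (m⊓n≤m _ _) (⊖-within-interval a≤n 1≤u t≤a u≤t x≡ y≡)
  ... | inj₂ t≤u = ≤-<-trans (m⊓n≤n _ _) (⊖-within-interval a≤n 1≤t u≤a t≤u y≡ x≡)

  offset⇒dist> : ∀ {x y : Fin n} {v b} → toℕ y ≡ (toℕ x + v) % n → b < v → b + v < n →
                 b < dist n x y
  offset⇒dist> {x} {y} {v} {b} y≡ b<v b+v<n =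
    ⊓-glb (subst (b <_) (sym x⊖y≡n∸v) (m+n≤o⇒m≤o∸n (suc b) b+v<n))
          (subst (b <_) (sym (⊖-unique v<n y≡)) b<v)
    where
      open ≡-Reasoning
      v<n = ≤-<-trans (m≤n+m v b) b+v<n
      x≡ : toℕ x ≡ (toℕ y + (n ∸ v)) % n
      x≡ = sym (begin
        (toℕ y + (n ∸ v)) % n       ≡⟨ offset-+ x v (n ∸ v) y≡ ⟩
        (toℕ x + (v + (n ∸ v))) % n ≡⟨ cong (λ z → (toℕ x + z) % n) (m+[n∸m]≡n (<⇒≤ v<n)) ⟩
        (toℕ x + n) % n             ≡⟨ [toℕ+n]%n≡toℕ x ⟩
        toℕ x                       ∎)
      x⊖y≡n∸v = ⊖-unique (∸-monoʳ-< {n} {v} {0} (≤-<-trans z≤n b<v) (<⇒≤ v<n)) x≡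

  -- The offset from a point of I_a to a point of I_i is δ + u − t with 1 ≤ t, u ≤ k.
  offset-far⇒IntervalDist≥ : ∀ {a i : Fin n} {δ b k} → toℕ i ≡ (toℕ a + δ) % n →
                             b + k < δ → δ + (b + k) < n → IntervalDist≥ n (suc k) a i (suc b)
  offset-far⇒IntervalDist≥ {a} {i} {δ} {b} {k} i≡ b+k<δ δ+b+k<n
    x y (suc t , _ , s≤s t≤k , x≡) (suc u , _ , s≤s u≤k , y≡)
    with m≤n⇒∃[o]m+o≡n (≤-trans t≤k (≤-trans (m≤n+m k b) (<⇒≤ b+k<δ)))
  ... | r , refl = offset⇒dist> y≡x+r+u b<r+u b+r+u<n
    where
      shuffle : ∀ t r u → t + r + suc u ≡ suc t + (r + u)
      shuffle = solve-∀
      y≡x+r+u : toℕ y ≡ (toℕ x + (r + u)) % n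
      y≡x+r+u = begin
        toℕ y                             ≡⟨ y≡ ⟩
        (toℕ i + suc u) % n               ≡⟨ offset-+ a (t + r) (suc u) i≡ ⟩
        (toℕ a + (t + r + suc u)) % n     ≡⟨ cong (λ z → (toℕ a + z) % n) (shuffle t r u) ⟩
        (toℕ a + (suc t + (r + u))) % n   ≡⟨ offset-+ a (suc t) (r + u) x≡ ⟨
        (toℕ x + (r + u)) % n             ∎
        where open ≡-Reasoning
      b<r : b < r
      b<r = +-cancelʳ-< t b r (≤-<-trans (+-monoʳ-≤ b t≤k) (subst (b + k <_) (+-comm t r) b+k<δ))
      b<r+u = ≤-trans b<r (m≤m+n r u)
      b+r+u<n : b + (r + u) < n
      b+r+u<n = ≤-<-trans b+r+u≤δ+b+k δ+b+k<n
        where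
          open ≤-Reasoning
          reorder : ∀ t r b k → t + (b + (r + k)) ≡ t + r + (b + k)
          reorder = solve-∀
          b+r+u≤δ+b+k = begin
            b + (r + u)         ≤⟨ +-monoʳ-≤ b (+-monoʳ-≤ r u≤k) ⟩
            b + (r + k)         ≤⟨ m≤n+m _ t ⟩
            t + (b + (r + k))   ≡⟨ reorder t r b k ⟩
            t + r + (b + k)     ∎

  _⊕_ : Fin n → ℕ → Fin n
  a ⊕ t = fromℕ< (m%n<n (toℕ a + t) n)

  toℕ-⊕ : ∀ a t → toℕ (a ⊕ t) ≡ (toℕ a + t) % n
  toℕ-⊕ a t = toℕ-fromℕ< (m%n<n (toℕ a + t) n)

  -- The 2r + 1 points a − r, …, a + r.
  window : Fin n → ℕ → List (Fin n)
  window a r = applyUpTo (λ s → a ⊕ (n ∸ r + s)) (suc (r + r))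

  length-window : ∀ a r → length (window a r) ≡ suc (r + r)
  length-window a r = length-applyUpTo (λ s → a ⊕ (n ∸ r + s)) (suc (r + r))

  ∈-window : ∀ {a x : Fin n} {r s} → r ≤ n → s ≤ r + r →
             (toℕ x + r) % n ≡ (toℕ a + s) % n → x ∈ window a r
  ∈-window {a} {x} {r} {s} r≤n s≤2r x+r≡a+s =
    subst (_∈ window a r) (sym x≡a⊕s) (∈-applyUpTo⁺ (λ s → a ⊕ (n ∸ r + s)) (s≤s s≤2r))
    where
      open ≡-Reasoning
      x≡a⊕s : x ≡ a ⊕ (n ∸ r + s)
      x≡a⊕s = toℕ-injective (begin
        toℕ x                              ≡⟨ [toℕ+n]%n≡toℕ x ⟨
        (toℕ x + n) % n                    ≡⟨ cong (λ z → (toℕ x + z) % n) (m+[n∸m]≡n r≤n) ⟨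
        (toℕ x + (r + (n ∸ r))) % n        ≡⟨ cong (_% n) (+-assoc (toℕ x) r (n ∸ r)) ⟨
        (toℕ x + r + (n ∸ r)) % n          ≡⟨ %-cong-+ʳ n (n ∸ r) x+r≡a+s ⟩
        (toℕ a + s + (n ∸ r)) % n          ≡⟨ cong (_% n) (+-assoc (toℕ a) s (n ∸ r)) ⟩
        (toℕ a + (s + (n ∸ r))) % n        ≡⟨ cong (λ z → (toℕ a + z) % n) (+-comm s (n ∸ r)) ⟩
        (toℕ a + (n ∸ r + s)) % n          ≡⟨ toℕ-⊕ a (n ∸ r + s) ⟨
        toℕ (a ⊕ (n ∸ r + s))              ∎)

  window-unique : ∀ a r → r + r < n → Unique (window a r)
  window-unique a r 2r<n =
    applyUpTo⁺₁ _ (suc (r + r)) λ s<s′ s′<2r+1 →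
      <⇒≢ s<s′ ∘ ⊕-injective (≤-pred (<-trans s<s′ s′<2r+1)) (≤-pred s′<2r+1)
    where
      open ≡-Reasoning
      q = n ∸ r
      regroup : ∀ s → toℕ a + (q + s) ≡ s + (toℕ a + q)
      regroup s = trans (sym (+-assoc (toℕ a) q s)) (+-comm (toℕ a + q) s)
      ⊕-injective : ∀ {s s′} → s ≤ r + r → s′ ≤ r + r → a ⊕ (q + s) ≡ a ⊕ (q + s′) → s ≡ s′
      ⊕-injective {s} {s′} s≤2r s′≤2r eq = begin
        s                      ≡⟨ m<n⇒m%n≡m (≤-<-trans s≤2r 2r<n) ⟨
        s % n                  ≡⟨ %-cancel-+ʳ n (toℕ a + q) shifted ⟩
        s′ % n                 ≡⟨ m<n⇒m%n≡m (≤-<-trans s′≤2r 2r<n) ⟩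
        s′                     ∎
        where
          shifted : (s + (toℕ a + q)) % n ≡ (s′ + (toℕ a + q)) % n
          shifted = begin
            (s + (toℕ a + q)) % n    ≡⟨ cong (_% n) (regroup s) ⟨
            (toℕ a + (q + s)) % n    ≡⟨ toℕ-⊕ a (q + s) ⟨
            toℕ (a ⊕ (q + s))        ≡⟨ cong toℕ eq ⟩
            toℕ (a ⊕ (q + s′))       ≡⟨ toℕ-⊕ a (q + s′) ⟩
            (toℕ a + (q + s′)) % n   ≡⟨ cong (_% n) (regroup s′) ⟩
            (s′ + (toℕ a + q)) % n   ∎

  IntervalsMeet⇒∈window : ∀ {j j₀ : Fin n} {r} → r ≤ n → IntervalsMeet n (suc r) j j₀ →
                          j ∈ window j₀ r
  IntervalsMeet⇒∈window {j} {j₀} r≤n (x , (suc t , _ , s≤s t≤r , x≡) , (suc u , _ , s≤s u≤r , x≡′))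
    with m≤n⇒∃[o]m+o≡n t≤r
  ... | p , refl = ∈-window {a = j₀} r≤n (+-mono-≤ u≤r (m≤n+m p t))
                     (%-cancel-+ʳ n 1 (begin
    (toℕ j + (t + p) + 1) % n     ≡⟨ cong (_% n) (shuffle (toℕ j) t p) ⟩
    (toℕ j + suc t + p) % n       ≡⟨ %-cong-+ʳ n p (trans (sym x≡) x≡′) ⟩
    (toℕ j₀ + suc u + p) % n      ≡⟨ cong (_% n) (shuffle (toℕ j₀) u p) ⟨
    (toℕ j₀ + (u + p) + 1) % n    ∎))
    where
      open ≡-Reasoning
      shuffle : ∀ j t p → j + (t + p) + 1 ≡ j + suc t + p
      shuffle = solve-∀

  offset⇒∈window⊎IntervalDist≥ : ∀ {a i : Fin n} {δ} b k → b + k ≤ n → δ < n →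
                                 toℕ i ≡ (toℕ a + δ) % n →
                                 i ∈ window a (b + k) ⊎ IntervalDist≥ n (suc k) a i (suc b)
  offset⇒∈window⊎IntervalDist≥ {a} {i} {δ} b k D≤n δ<n i≡ with δ ≤? b + k
  ... | yes δ≤D = inj₁ (∈-window {a = a} D≤n (+-monoˡ-≤ (b + k) δ≤D) (offset-+ a δ (b + k) i≡))
  ... | no δ≰D with n ≤? δ + (b + k)
  ...   | no n≰δ+D = inj₂ (offset-far⇒IntervalDist≥ i≡ (≰⇒> δ≰D) (≰⇒> n≰δ+D))
  ...   | yes n≤δ+D with m≤n⇒∃[o]m+o≡n n≤δ+D
  ...     | w , n+w≡δ+D = inj₁ (∈-window {a = a} D≤n (≤-trans (<⇒≤ w<D) (m≤m+n D D)) (begin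
    (toℕ i + D) % n          ≡⟨ offset-+ a δ D i≡ ⟩
    (toℕ a + (δ + D)) % n    ≡⟨ cong (λ z → (toℕ a + z) % n) n+w≡δ+D ⟨
    (toℕ a + (n + w)) % n    ≡⟨ cong (_% n) (regroup (toℕ a) n w) ⟩
    (toℕ a + w + n) % n      ≡⟨ [m+n]%n≡m%n (toℕ a + w) n ⟩
    (toℕ a + w) % n          ∎))
    where
      open ≡-Reasoning
      D = b + k
      regroup : ∀ a n w → a + (n + w) ≡ a + w + n
      regroup = solve-∀
      w<D : w < D
      w<D = +-cancelˡ-< n w D (subst (_< n + D) (sym n+w≡δ+D) (+-monoˡ-< D δ<n))

  ∈window⊎IntervalDist≥ : ∀ (a i : Fin n) b k → b + k ≤ n →
                          i ∈ window a (b + k) ⊎ IntervalDist≥ n (suc k) a i (suc b)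
  ∈window⊎IntervalDist≥ a i b k D≤n =
    offset⇒∈window⊎IntervalDist≥ b k D≤n (⊖-< i a) (⊖-offset i a)

-- The count x * N + (ℓ + ℓ + 1 − x) * c, written without truncated subtraction.
column-count≤ : ∀ {x ℓ c N} → x ≤ ℓ → c ≤ N →
                suc (ℓ + ℓ) * c + x * (N ∸ c) ≤ ℓ * N + suc ℓ * c
column-count≤ {x} {ℓ} {c} {N} x≤ℓ c≤N = begin
  suc (ℓ + ℓ) * c + x * (N ∸ c)   ≤⟨ +-monoʳ-≤ (suc (ℓ + ℓ) * c) (*-monoˡ-≤ (N ∸ c) x≤ℓ) ⟩
  suc (ℓ + ℓ) * c + ℓ * (N ∸ c)   ≡⟨ regroup ℓ c (N ∸ c) ⟩
  ℓ * (c + (N ∸ c)) + suc ℓ * c   ≡⟨ cong (λ z → ℓ * z + suc ℓ * c) (m+[n∸m]≡n c≤N) ⟩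
  ℓ * N + suc ℓ * c               ∎
  where
    open ≤-Reasoning
    regroup : ∀ ℓ c d → suc (ℓ + ℓ) * c + ℓ * d ≡ ℓ * (c + d) + suc ℓ * c
    regroup = solve-∀

window-size≤ : ∀ {k b} → suc k ≤ b → suc (b + k + (b + k)) ≤ 4 * b
window-size≤ {k} k<b with m≤n⇒∃[o]m+o≡n k<b
... | r , refl = ≤-trans (m≤m+n _ (suc (r + r))) (≤-reflexive (regroup k r))
  where
    regroup : ∀ k r → suc (suc k + r + k + (suc k + r + k)) + suc (r + r) ≡ 4 * (suc k + r)
    regroup = solve-∀

-- k′ and ℓ′ stand for k − 1 and ℓ − 1.
module BlockedFamily
  (k′ ℓ′ b n₁ n₂ : ℕ) .{{_ : NonZero n₁}} .{{_ : NonZero n₂}}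
  (k≤b : suc k′ ≤ b) (ℓ≤b : suc ℓ′ ≤ b)
  (2[k+b]<n₁ : 2 * (suc k′ + b) < n₁) (2[ℓ+b]<n₂ : 2 * (suc ℓ′ + b) < n₂)
  (ℛ : List (Rect n₁ n₂)) (ℛ-unique : Unique ℛ)
  (ℛ-projIntersecting : ProjIntersectingFamily n₁ n₂ (suc k′) (suc ℓ′) ℛ)
  (B : List (Fin n₂)) (B-blocking : ∀ j → (j ∈ B) ⇔ IsBlockingBase n₁ n₂ (suc k′) b ℛ j)
  (j₀ : Fin n₂) (j₀∈B : j₀ ∈ B) (|B|≤ℓ′ : length B ≤ ℓ′)
  where

  open import Data.List.Membership.DecPropositional (_≟_ {n₂}) using (_∈?_)
  module C₁ = Cyclic n₁
  module C₂ = Cyclic n₂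

  D c : ℕ
  D = b + k′
  c = suc (D + D)

  c<n₁ : c < n₁
  c<n₁ = <-trans (≤-reflexive (regroup k′ b)) 2[k+b]<n₁
    where
      regroup : ∀ k b → suc (suc (b + k + (b + k))) ≡ 2 * (suc k + b)
      regroup = solve-∀

  D≤n₁ : D ≤ n₁
  D≤n₁ = ≤-trans (m≤m+n D D) (≤-trans (n≤1+n _) (<⇒≤ c<n₁))

  k≤n₁ : suc k′ ≤ n₁
  k≤n₁ = ≤-trans k≤b (≤-trans (m≤m+n b k′) D≤n₁)

  2ℓ′<n₂ : ℓ′ + ℓ′ < n₂
  2ℓ′<n₂ = ≤-trans (≤-trans (m≤m+n _ (suc (b + b))) (≤-reflexive (regroup ℓ′ b))) (<⇒≤ 2[ℓ+b]<n₂)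
    where
      regroup : ∀ ℓ b → suc (ℓ + ℓ) + suc (b + b) ≡ 2 * (suc ℓ + b)
      regroup = solve-∀

  ℓ′≤n₂ : ℓ′ ≤ n₂
  ℓ′≤n₂ = ≤-trans (m≤m+n ℓ′ ℓ′) (<⇒≤ 2ℓ′<n₂)

  -- A rectangle avoiding J₀ would have to meet both I₁ and I₂, which are too far apart.
  base∈window : ∀ {i j} → (i , j) ∈ ℛ → j ∈ C₂.window j₀ ℓ′
  base∈window R∈ with Equivalence.to (B-blocking j₀) j₀∈B
  ... | i₁ , i₂ , R₁∈ , R₂∈ , I₁I₂-apart
      with ℛ-projIntersecting _ _ R∈ R₁∈ | ℛ-projIntersecting _ _ R∈ R₂∈
  ...   | inj₂ J∩J₀ | _         = C₂.IntervalsMeet⇒∈window ℓ′≤n₂ J∩J₀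
  ...   | inj₁ _    | inj₂ J∩J₀ = C₂.IntervalsMeet⇒∈window ℓ′≤n₂ J∩J₀
  ...   | inj₁ (x , x∈I , x∈I₁) | inj₁ (y , y∈I , y∈I₂) =
    ⊥-elim (<-irrefl refl (<-≤-trans (<-trans (I₁I₂-apart x y x∈I₁ y∈I₂)
                                               (C₁.InInterval⇒dist< k≤n₁ x∈I y∈I)) k≤b))

  column : Fin n₂ → List (Rect n₁ n₂)
  column j = filter (λ R → proj₂ R ≟ j) ℛ

  column-unique : ∀ j → Unique (column j)
  column-unique j = filter⁺ (λ R → proj₂ R ≟ j) ℛ-unique

  length-column≤n₁ : ∀ j → length (column j) ≤ n₁
  length-column≤n₁ j = begin
    length (column j)                      ≤⟨ Unique-⊆⇒length≤ (column-unique j) column⊆line ⟩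
    length (map (λ i → (i , j)) (allFin n₁)) ≡⟨ length-map _ (allFin n₁) ⟩
    length (allFin n₁)                     ≡⟨ length-tabulate (λ i → i) ⟩
    n₁                                     ∎
    where
      open ≤-Reasoning
      column⊆line : ∀ {R} → R ∈ column j → R ∈ map (λ i → (i , j)) (allFin n₁)
      column⊆line {i , _} R∈ with ∈-filter⁻ (λ R → proj₂ R ≟ j) {xs = ℛ} R∈
      ... | _ , refl = ∈-map⁺ (λ i → (i , j)) (∈-allFin i)

  length-column≤c : ∀ j → ¬ j ∈ B → length (column j) ≤ c
  length-column≤c j j∉B = Unique⇒length≤-around around (column-unique j) clustered
    λ R → ≤-reflexive (trans (length-map _ (C₁.window (proj₁ R) D)) (C₁.length-window (proj₁ R) D))
    where
      around : Rect n₁ n₂ → List (Rect n₁ n₂)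
      around (a , j′) = map (λ i → (i , j′)) (C₁.window a D)
      clustered : ∀ {R R′} → R ∈ column j → R′ ∈ column j → R′ ∈ around R
      clustered {a , _} {i , _} R∈ R′∈
        with ∈-filter⁻ (λ R → proj₂ R ≟ j) {xs = ℛ} R∈ | ∈-filter⁻ (λ R → proj₂ R ≟ j) {xs = ℛ} R′∈
      ... | a∈ℛ , refl | i∈ℛ , refl with C₁.∈window⊎IntervalDist≥ a i b k′ D≤n₁
      ...   | inj₁ i∈W = ∈-map⁺ (λ i → (i , j)) i∈W
      ...   | inj₂ apart =
        ⊥-elim (j∉B (Equivalence.from (B-blocking j) (a , i , a∈ℛ , i∈ℛ , apart)))

  W : List (Fin n₂)
  W = C₂.window j₀ ℓ′

  ℛ⊆columns : ∀ {R} → R ∈ ℛ → R ∈ concatMap column W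
  ℛ⊆columns {i , j} R∈ =
    ∈-concatMap⁺ column
      (Any.map (λ { refl → ∈-filter⁺ (λ R → proj₂ R ≟ j) R∈ refl }) (base∈window R∈))

  length-blocking-in-window≤ℓ′ : length (filter (_∈? B) W) ≤ ℓ′
  length-blocking-in-window≤ℓ′ =
    ≤-trans (Unique-⊆⇒length≤ (filter⁺ (_∈? B) (C₂.window-unique j₀ ℓ′ 2ℓ′<n₂))
                              (proj₂ ∘ ∈-filter⁻ (_∈? B) {xs = W}))
            |B|≤ℓ′

  length-ℛ≤ : length ℛ ≤ 4 * b * b + ℓ′ * n₁
  length-ℛ≤ = begin
    length ℛ
      ≤⟨ Unique-⊆⇒length≤ ℛ-unique ℛ⊆columns ⟩
    length (concatMap column W)
      ≤⟨ length-concatMap≤ (_∈? B) column length-column≤c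
           (λ j → ≤-trans (length-column≤n₁ j) (m≤n+m∸n n₁ c)) W ⟩
    length W * c + length (filter (_∈? B) W) * (n₁ ∸ c)
      ≡⟨ cong (λ z → z * c + length (filter (_∈? B) W) * (n₁ ∸ c)) (C₂.length-window j₀ ℓ′) ⟩
    suc (ℓ′ + ℓ′) * c + length (filter (_∈? B) W) * (n₁ ∸ c)
      ≤⟨ column-count≤ length-blocking-in-window≤ℓ′ (<⇒≤ c<n₁) ⟩
    ℓ′ * n₁ + suc ℓ′ * c
      ≤⟨ +-monoʳ-≤ (ℓ′ * n₁) (*-mono-≤ ℓ≤b (window-size≤ k≤b)) ⟩
    ℓ′ * n₁ + b * (4 * b)
      ≡⟨ +-comm (ℓ′ * n₁) _ ⟩
    b * (4 * b) + ℓ′ * n₁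
      ≡⟨ cong (_+ ℓ′ * n₁) (*-comm b (4 * b)) ⟩
    4 * b * b + ℓ′ * n₁
      ∎
    where open ≤-Reasoning

lemma6 : (k ℓ b n₁ n₂ : ℕ) → .{{_ : NonZero n₁}} → .{{_ : NonZero n₂}} →
         1 ≤ k → 1 ≤ ℓ → 1 ≤ b → k ≤ b → ℓ ≤ b →
         2 * (k + b) < n₁ → 2 * (ℓ + b) < n₂ →
         (ℛ : List (Rect n₁ n₂)) → Unique ℛ →
         ProjIntersectingFamily n₁ n₂ k ℓ ℛ →
         (B : List (Fin n₂)) → Unique B →
         (∀ j → (j ∈ B) ⇔ IsBlockingBase n₁ n₂ k b ℛ j) →
         1 ≤ length B → length B ≤ ℓ ∸ 1 →
         length ℛ ≤ 4 * b * b + (ℓ ∸ 1) * n₁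
lemma6 (suc k′) (suc ℓ′) b n₁ n₂ _ _ _ k≤b ℓ≤b 2[k+b]<n₁ 2[ℓ+b]<n₂
       ℛ ℛ-unique ℛ-projIntersecting (j₀ ∷ B′) _ B-blocking _ |B|≤ℓ′ =
  BlockedFamily.length-ℛ≤ k′ ℓ′ b n₁ n₂ k≤b ℓ≤b 2[k+b]<n₁ 2[ℓ+b]<n₂
    ℛ ℛ-unique ℛ-projIntersecting (j₀ ∷ B′) B-blocking j₀ (here refl) |B|≤ℓ′
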